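{- Let $s \in \Sigma^*$ with $|s| = n$ and $\mathcal{F}(s) = [(\sigma_0,p_0), \ldots, (\sigma_{k-1},p_{k-1})]$. Then the multiset union of the characters of $\sigma_0, \ldots, \sigma_{k-1}$ equals the multiset of characters of $\hat{s}$. In particular $\sum_{d=0}^{k-1} |\sigma_d| = n+2$.
   Context: Let $\Sigma$ be an alphabet and let $\texttt{@}$ and $\texttt{\$}$ be two distinct symbols not in $\Sigma$. For $s \in \Sigma^*$ let $\hat{s} = \texttt{@}\, s\, \texttt{\$}$. The leading run of a non-empty string is its longest prefix consisting of a single repeated symbol; the trailing run is its longest suffix consisting of a single repeated symbol. A bilateral token is a pair $(\sigma,p)$ with $\sigma$ a non-empty string and $p \in \mathbb{N}_0$. The Flashback decomposition $\mathcal{F}(s)$ is produced as follows, starting with active span $\hat{s}$: (i) if the active span is empty, stop; (ii) let $\ell$ be the length of its leading run; if $\ell$ equals the length of the span, append (span, $0$) and stop; (iii) otherwise let $\sigma$ be the leading run followed by the trailing run, and let the middle be the span with its leading and trailing runs removed; if the middle is empty append $(\sigma,0)$ and stop, otherwise append $(\sigma,\ell)$ and continue with the middle as the new active span. -}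

module Defs where

open import Data.Nat using (ℕ; zero; suc; _+_)
open import Data.List using (List; []; _∷_; length; reverse; takeWhile; drop; _++_)
open import Data.Product using (_×_; _,_)
open import Relation.Binary.Definitions using (DecidableEquality)
open import Relation.Binary.PropositionalEquality using (_≡_; refl; cong)
open import Relation.Nullary using (yes; no)
open import Relation.Nullary.Decidable using (map′)
open import Data.Nat using (_≟_)

data Sym (A : Set) : Set where
  ch     : A → Sym A
  at     : Sym A
  dollar : Sym A

module _ {A : Set} (_≟A_ : DecidableEquality A) where

  ch-inj : ∀ {a b : A} → ch a ≡ ch b → a ≡ b
  ch-inj refl = refl

  _≟S_ : DecidableEquality (Sym A)
  ch a ≟S ch b with a ≟A b
  ... | yes p = yes (cong ch p)
  ... | no ¬p = no (λ q → ¬p (ch-inj q))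
  ch a ≟S at = no (λ ())
  ch a ≟S dollar = no (λ ())
  at ≟S ch b = no (λ ())
  at ≟S at = yes refl
  at ≟S dollar = no (λ ())
  dollar ≟S ch b = no (λ ())
  dollar ≟S at = no (λ ())
  dollar ≟S dollar = yes refl

  leadingRun : List (Sym A) → List (Sym A)
  leadingRun []       = []
  leadingRun (x ∷ xs) = x ∷ takeWhile (x ≟S_) xs

  trailingRun : List (Sym A) → List (Sym A)
  trailingRun xs = reverse (leadingRun (reverse xs))

  dropLast : ℕ → List (Sym A) → List (Sym A)
  dropLast k xs = reverse (drop k (reverse xs))

  Token : Set
  Token = List (Sym A) × ℕ

  -- Flashback decomposition on an active span, with a fuel argument that
  -- bounds the number of steps (each step consumes at least one symbol,
  -- so fuel = length of the span is always sufficient).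
  flashback : ℕ → List (Sym A) → List Token
  flashback _          []   = []
  flashback zero       (_ ∷ _) = []
  flashback (suc fuel) span@(_ ∷ _) with length (leadingRun span) ≟ length span
  ... | yes _ = (span , 0) ∷ []
  ... | no _ with dropLast (length (trailingRun span)) (drop (length (leadingRun span)) span)
  ...   | [] = (leadingRun span ++ trailingRun span , 0) ∷ []
  ...   | middle@(_ ∷ _) =
            (leadingRun span ++ trailingRun span , length (leadingRun span))
              ∷ flashback fuel middle

  hat : List A → List (Sym A)
  hat s = at ∷ (Data.List.map ch s ++ dollar ∷ [])

  𝓕 : List A → List Token
  𝓕 s = flashback (length (hat s)) (hat s)

-- Every step cuts the active span into leading run, middle and trailing run,
-- emits the two runs as one token and continues on the middle, so by induction
-- the token strings are a rearrangement of ŝ; the length identity follows since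
-- permutations preserve length.  The cut is exact because, when the span is not
-- a single run, the symbol right after the leading run does not occur in it, so
-- the trailing run cannot reach back into the leading run.
module Submission where

open import Defs
open import Data.Nat using (suc; _+_; _≤_; _<_; s≤s)
import Data.Nat as Nat
open import Data.Nat.Properties using (≤-refl; ≤-trans; ≤-pred; module ≤-Reasoning)
open import Data.Nat.ListAction using (sum)
open import Data.List
  using (List; []; _∷_; [_]; _++_; _∷ʳ_; length; map; concat; reverse; drop; takeWhile)
open import Data.List.Properties
  using (length-++; length-++-≤ˡ; length-++-≤ʳ; ++-assoc; ++-identityʳ; ∷ʳ-++; map-∘;
         reverse-++; unfold-reverse; reverse-involutive; length-reverse)
open import Data.List.Membership.Propositional using (_∉_)
open import Data.List.Relation.Unary.Any using (here; there)
import Data.List.Relation.Unary.Any.Properties as Any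
import Data.List.Relation.Unary.All as All
open import Data.List.Relation.Unary.All.Properties using (all-takeWhile)
open import Data.List.Relation.Binary.Permutation.Propositional
  using (_↭_; ↭-refl; ↭-reflexive; module PermutationReasoning)
open import Data.List.Relation.Binary.Permutation.Propositional.Properties
  using (↭-length; ++⁺ˡ; ++⁺ʳ; ++-comm)
open import Data.Product using (_×_; _,_; proj₁)
open import Data.Empty using (⊥-elim)
open import Function using (_∘_)
open import Relation.Binary.Definitions using (DecidableEquality)
open import Relation.Binary.PropositionalEquality using (_≡_; _≢_; refl; sym; trans; cong; module ≡-Reasoning)
open import Relation.Nullary using (yes; no; ¬_)
open import Relation.Unary using (Pred; Decidable)

length-concat : ∀ {B : Set} (xss : List (List B)) → length (concat xss) ≡ sum (map length xss)
length-concat []         = refl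
length-concat (xs ∷ xss) = trans (length-++ xs) (cong (length xs +_) (length-concat xss))

module _ {B : Set} {p} {P : Pred B p} (P? : Decidable P) where

  takeWhile-++-drop : ∀ xs → takeWhile P? xs ++ drop (length (takeWhile P? xs)) xs ≡ xs
  takeWhile-++-drop []       = refl
  takeWhile-++-drop (x ∷ xs) with P? x
  ... | yes _ = cong (x ∷_) (takeWhile-++-drop xs)
  ... | no _  = refl

  drop-takeWhile-¬ : ∀ xs {r rs} → drop (length (takeWhile P? xs)) xs ≡ r ∷ rs → ¬ P r
  drop-takeWhile-¬ (x ∷ xs) eq with P? x
  drop-takeWhile-¬ (x ∷ xs) eq   | yes _  = drop-takeWhile-¬ xs eq
  drop-takeWhile-¬ (x ∷ xs) refl | no ¬px = ¬px

  takeWhile-++-∷-∷ : ∀ v {y z w} → ¬ (P y × P z) →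
    takeWhile P? (v ++ y ∷ z ∷ w) ≡ takeWhile P? (v ++ [ y ])
  takeWhile-++-∷-∷ [] {y} {z} ¬py×pz with P? y
  ... | no _ = refl
  ... | yes py with P? z
  ...   | yes pz = ⊥-elim (¬py×pz (py , pz))
  ...   | no _   = refl
  takeWhile-++-∷-∷ (a ∷ v) ¬py×pz with P? a
  ... | yes _ = cong (a ∷_) (takeWhile-++-∷-∷ v ¬py×pz)
  ... | no _  = refl

module _ {A : Set} (_≟A_ : DecidableEquality A) where

  private
    _≟_ : DecidableEquality (Sym A)
    _≟_ = _≟S_ _≟A_

  middle : List (Sym A) → List (Sym A)
  middle xs = dropLast _≟A_ (length (trailingRun _≟A_ xs)) (drop (length (leadingRun _≟A_ xs)) xs)

  length-hat : ∀ s → length (hat _≟A_ s) ≡ length s + 2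
  length-hat []      = refl
  length-hat (_ ∷ s) = cong suc (length-hat s)

  leadingRun-++-drop : ∀ xs → leadingRun _≟A_ xs ++ drop (length (leadingRun _≟A_ xs)) xs ≡ xs
  leadingRun-++-drop []       = refl
  leadingRun-++-drop (x ∷ xs) = cong (x ∷_) (takeWhile-++-drop (x ≟_) xs)

  ∉-leadingRun : ∀ xs {r rs} → drop (length (leadingRun _≟A_ xs)) xs ≡ r ∷ rs → r ∉ leadingRun _≟A_ xs
  ∉-leadingRun (x ∷ xs) eq (here r≡x) = drop-takeWhile-¬ (x ≟_) xs eq (sym r≡x)
  ∉-leadingRun (x ∷ xs) eq (there r∈) =
    drop-takeWhile-¬ (x ≟_) xs eq (All.lookup (all-takeWhile (x ≟_) xs) r∈)

  leadingRun-++-∉ : ∀ v {z u} → z ∉ u → leadingRun _≟A_ (v ++ z ∷ u) ≡ leadingRun _≟A_ (v ++ [ z ])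
  leadingRun-++-∉ v {u = []} _ = refl
  leadingRun-++-∉ [] {z} {w ∷ _} z∉u with z ≟ w
  ... | yes z≡w = ⊥-elim (z∉u (here z≡w))
  ... | no _    = refl
  leadingRun-++-∉ (a ∷ v) {u = _ ∷ _} z∉u =
    cong (a ∷_) (takeWhile-++-∷-∷ (a ≟_) v λ (a≡z , a≡w) → z∉u (here (trans (sym a≡z) a≡w)))

  trailingRun-++-∉ : ∀ u {r} rs → r ∉ u → trailingRun _≟A_ (u ++ r ∷ rs) ≡ trailingRun _≟A_ (r ∷ rs)
  trailingRun-++-∉ u {r} rs r∉u = cong reverse (begin
    leadingRun _≟A_ (reverse (u ++ r ∷ rs))
      ≡⟨ cong (leadingRun _≟A_) (reverse-++ u (r ∷ rs)) ⟩
    leadingRun _≟A_ (reverse (r ∷ rs) ++ reverse u)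
      ≡⟨ cong (λ v → leadingRun _≟A_ (v ++ reverse u)) (unfold-reverse r rs) ⟩
    leadingRun _≟A_ ((reverse rs ∷ʳ r) ++ reverse u)
      ≡⟨ cong (leadingRun _≟A_) (∷ʳ-++ (reverse rs) r (reverse u)) ⟩
    leadingRun _≟A_ (reverse rs ++ r ∷ reverse u)
      ≡⟨ leadingRun-++-∉ (reverse rs) (r∉u ∘ Any.reverse⁻) ⟩
    leadingRun _≟A_ (reverse rs ∷ʳ r)
      ≡⟨ cong (leadingRun _≟A_) (unfold-reverse r rs) ⟨
    leadingRun _≟A_ (reverse (r ∷ rs))
      ∎)
    where open ≡-Reasoning

  dropLast-++-trailingRun : ∀ xs → dropLast _≟A_ (length (trailingRun _≟A_ xs)) xs ++ trailingRun _≟A_ xs ≡ xs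
  dropLast-++-trailingRun xs = begin
    reverse (drop (length (reverse L)) (reverse xs)) ++ reverse L
      ≡⟨ cong (λ n → reverse (drop n (reverse xs)) ++ reverse L) (length-reverse L) ⟩
    reverse (drop (length L) (reverse xs)) ++ reverse L
      ≡⟨ reverse-++ L (drop (length L) (reverse xs)) ⟨
    reverse (L ++ drop (length L) (reverse xs))
      ≡⟨ cong reverse (leadingRun-++-drop (reverse xs)) ⟩
    reverse (reverse xs)
      ≡⟨ reverse-involutive xs ⟩
    xs
      ∎
    where
    open ≡-Reasoning
    L = leadingRun _≟A_ (reverse xs)

  length-leadingRun≡length : ∀ xs → drop (length (leadingRun _≟A_ xs)) xs ≡ [] →
    length (leadingRun _≟A_ xs) ≡ length xs
  length-leadingRun≡length xs eq = begin
    length L          ≡⟨ cong length (++-identityʳ L) ⟨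
    length (L ++ [])  ≡⟨ cong (λ v → length (L ++ v)) eq ⟨
    length (L ++ R)   ≡⟨ cong length (leadingRun-++-drop xs) ⟩
    length xs         ∎
    where
    open ≡-Reasoning
    L = leadingRun _≟A_ xs
    R = drop (length L) xs

  trailingRun-drop-leadingRun : ∀ xs → length (leadingRun _≟A_ xs) ≢ length xs →
    trailingRun _≟A_ xs ≡ trailingRun _≟A_ (drop (length (leadingRun _≟A_ xs)) xs)
  trailingRun-drop-leadingRun xs |L|≢|xs| with drop (length (leadingRun _≟A_ xs)) xs in eq
  ... | []     = ⊥-elim (|L|≢|xs| (length-leadingRun≡length xs eq))
  ... | r ∷ rs = begin
    trailingRun _≟A_ xs             ≡⟨ cong (trailingRun _≟A_) (leadingRun-++-drop xs) ⟨
    trailingRun _≟A_ (L ++ R)       ≡⟨ cong (λ v → trailingRun _≟A_ (L ++ v)) eq ⟩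
    trailingRun _≟A_ (L ++ r ∷ rs)  ≡⟨ trailingRun-++-∉ L rs (∉-leadingRun xs eq) ⟩
    trailingRun _≟A_ (r ∷ rs)       ∎
    where
    open ≡-Reasoning
    L = leadingRun _≟A_ xs
    R = drop (length L) xs

  leadingRun-++-middle-++-trailingRun : ∀ xs → length (leadingRun _≟A_ xs) ≢ length xs →
    leadingRun _≟A_ xs ++ middle xs ++ trailingRun _≟A_ xs ≡ xs
  leadingRun-++-middle-++-trailingRun xs |L|≢|xs| = begin
    L ++ dropLast _≟A_ (length T) R ++ T
      ≡⟨ cong (λ t → L ++ dropLast _≟A_ (length t) R ++ t) (trailingRun-drop-leadingRun xs |L|≢|xs|) ⟩
    L ++ dropLast _≟A_ (length (trailingRun _≟A_ R)) R ++ trailingRun _≟A_ R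
      ≡⟨ cong (L ++_) (dropLast-++-trailingRun R) ⟩
    L ++ R
      ≡⟨ leadingRun-++-drop xs ⟩
    xs
      ∎
    where
    open ≡-Reasoning
    L = leadingRun _≟A_ xs
    R = drop (length L) xs
    T = trailingRun _≟A_ xs

  length-middle< : ∀ xs → length (leadingRun _≟A_ xs) ≢ length xs → length (middle xs) < length xs
  length-middle< [] |L|≢|xs| = ⊥-elim (|L|≢|xs| refl)
  length-middle< xs@(x ∷ xs′) |L|≢|xs| = begin-strict
    length M              <⟨ s≤s (≤-trans (length-++-≤ˡ M) (length-++-≤ʳ (M ++ T) {takeWhile (x ≟_) xs′})) ⟩
    length (L ++ M ++ T)  ≡⟨ cong length (leadingRun-++-middle-++-trailingRun xs |L|≢|xs|) ⟩
    length xs             ∎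
    where
    open ≤-Reasoning
    L = leadingRun _≟A_ xs
    M = middle xs
    T = trailingRun _≟A_ xs

  flashback-↭ : ∀ fuel xs → length xs ≤ fuel → concat (map proj₁ (flashback _≟A_ fuel xs)) ↭ xs
  flashback-↭ _          []         _ = ↭-refl
  flashback-↭ (suc fuel) xs@(_ ∷ _) |xs|≤1+fuel with length (leadingRun _≟A_ xs) Nat.≟ length xs
  ... | yes _ = ↭-reflexive (++-identityʳ xs)
  ... | no |L|≢|xs|
    with middle xs | leadingRun-++-middle-++-trailingRun xs |L|≢|xs| | length-middle< xs |L|≢|xs|
  ...   | [] | split | _ = ↭-reflexive (trans (++-identityʳ _) split)
  ...   | M@(_ ∷ _) | split | |M|<|xs| = begin
    (L ++ T) ++ C  ≡⟨ ++-assoc L T C ⟩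
    L ++ T ++ C    ↭⟨ ++⁺ˡ L (++-comm T C) ⟩
    L ++ C ++ T    ↭⟨ ++⁺ˡ L (++⁺ʳ T (flashback-↭ fuel M (≤-pred (≤-trans |M|<|xs| |xs|≤1+fuel)))) ⟩
    L ++ M ++ T    ≡⟨ split ⟩
    xs             ∎
    where
    open PermutationReasoning
    L = leadingRun _≟A_ xs
    T = trailingRun _≟A_ xs
    C = concat (map proj₁ (flashback _≟A_ fuel M))

mainTheorem4 : (A : Set) (_≟A_ : DecidableEquality A) (s : List A) →
    (concat (map proj₁ (𝓕 _≟A_ s)) ↭ hat _≟A_ s)
      × (sum (map (λ t → length (proj₁ t)) (𝓕 _≟A_ s)) ≡ length s + 2)
mainTheorem4 A _≟A_ s = tokens↭ŝ , lengths
  where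
  open ≡-Reasoning
  F = 𝓕 _≟A_ s
  tokens↭ŝ : concat (map proj₁ F) ↭ hat _≟A_ s
  tokens↭ŝ = flashback-↭ _≟A_ (length (hat _≟A_ s)) (hat _≟A_ s) ≤-refl
  lengths : sum (map (λ t → length (proj₁ t)) F) ≡ length s + 2
  lengths = begin
    sum (map (length ∘ proj₁) F)    ≡⟨ cong sum (map-∘ F) ⟩
    sum (map length (map proj₁ F))  ≡⟨ length-concat (map proj₁ F) ⟨
    length (concat (map proj₁ F))   ≡⟨ ↭-length tokens↭ŝ ⟩
    length (hat _≟A_ s)             ≡⟨ length-hat _≟A_ s ⟩
    length s + 2                    ∎
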